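{- For every integer $n$, \[ 25\sum_{k=1}^n F_k^{\,4} = F_{2n+1}L_{n-1}L_{n+2}+6n+3 . \]
   Context: $F_n$ and $L_n$ ($n\in\mathbb{Z}$) are the Fibonacci and Lucas numbers: $F_n=F_{n-1}+F_{n-2}$ with $F_0=0$, $F_1=1$; $L_n=L_{n-1}+L_{n-2}$ with $L_0=2$, $L_1=1$; extended to negative indices by $F_{ -n}=(-1)^{n-1}F_n$, $L_{ -n}=(-1)^nL_n$. For $n=0$ the sum $\sum_{k=1}^n$ is empty. For $n<0$ the sum follows the convention $\sum_{k=1}^n a_k=-\sum_{k=n+1}^{0}a_k$. -}

module Defs where

open import Data.Nat using (ℕ; zero; suc)
open import Data.Integer using (ℤ; +_; -[1+_]; _+_; _-_; -_; _*_)

fibℕ : ℕ → ℤ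
fibℕ zero = + 0
fibℕ (suc zero) = + 1
fibℕ (suc (suc n)) = fibℕ (suc n) + fibℕ n

lucℕ : ℕ → ℤ
lucℕ zero = + 2
lucℕ (suc zero) = + 1
lucℕ (suc (suc n)) = lucℕ (suc n) + lucℕ n

sgn : ℕ → ℤ
sgn zero = + 1
sgn (suc m) = - sgn m

-- Extension to ℤ: F_{-n} = (-1)^{n-1} F_n, L_{-n} = (-1)^n L_n.
-- Here -[1+ m ] = -(m+1), so F_{-(m+1)} = (-1)^m F_{m+1}, L_{-(m+1)} = (-1)^{m+1} L_{m+1}.
F : ℤ → ℤ
F (+ n) = fibℕ n
F -[1+ m ] = sgn m * fibℕ (suc m)

L : ℤ → ℤ
L (+ n) = lucℕ n
L -[1+ m ] = sgn (suc m) * lucℕ (suc m)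

sumℕ : (ℤ → ℤ) → ℕ → ℤ
sumℕ a zero = + 0
sumℕ a (suc n) = sumℕ a n + a (+ suc n)

-- Σ_{k=n+1}^{0} a k for n = -(m+1): the terms a(-m), ..., a(0)
sumNeg : (ℤ → ℤ) → ℕ → ℤ
sumNeg a zero = a (+ 0)
sumNeg a (suc m) = sumNeg a m + a -[1+ m ]

-- Σ_{k=1}^{n} a k for n : ℤ, with convention Σ_{k=1}^{n} = - Σ_{k=n+1}^{0} for n < 0
sumTo : (ℤ → ℤ) → ℤ → ℤ
sumTo a (+ n) = sumℕ a n
sumTo a -[1+ m ] = - sumNeg a m

-- Both sides change by 25 F_{n+1}^4 when n increases by 1, and they agree at n = 0.
-- For the right-hand side write a = F_n, b = F_{n+1}: then F_{2n+1} = a² + b²,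
-- L_{n-1} = 3a − b and L_{n+2} = a + 3b, and the increment becomes a polynomial
-- identity modulo Cassini's (b² − ab − a²)² = 1. These shift identities hold because a
-- two-sided sequence satisfying the Fibonacci recurrence is determined by two
-- consecutive values, hence is a fixed combination of F_n and F_{n+1}.
module Submission where

open import Defs
open import Data.Nat using (zero; suc)
import Data.Nat.Properties as ℕ
open import Data.Integer using (ℤ; -1ℤ; +_; -[1+_]; _+_; _-_; -_; _*_; _^_)
open import Data.Integer.Properties
  using (+-comm; +-identityˡ; +-inverseˡ; *-identityˡ; *-distribˡ-+; -1*i≡-i; +-0-abelianGroup)
open import Data.Integer.Tactic.RingSolver using (solve-∀)
open import Data.Product using (_×_; _,_; proj₁)
open import Relation.Binary.PropositionalEquality
open import Algebra.Properties.AbelianGroup +-0-abelianGroup using (∙-cancelˡ; ∙-cancelʳ)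
open ≡-Reasoning

ℤ-induction : ∀ {ℓ} (P : ℤ → Set ℓ) → P (+ 0) →
              (∀ n → P n → P (n + + 1)) → (∀ n → P (n + + 1) → P n) → ∀ n → P n
ℤ-induction P p₀ up down (+ zero)        = p₀
ℤ-induction P p₀ up down (+ suc k)       =
  subst P (cong +_ (ℕ.+-comm k 1)) (up (+ k) (ℤ-induction P p₀ up down (+ k)))
ℤ-induction P p₀ up down -[1+ zero ]     = down -[1+ 0 ] p₀
ℤ-induction P p₀ up down -[1+ suc m ]    = down -[1+ suc m ] (ℤ-induction P p₀ up down -[1+ m ])

≡-from-increments : ∀ {f g : ℤ → ℤ} (d : ℤ → ℤ) → f (+ 0) ≡ g (+ 0) →
                    (∀ n → f (n + + 1) ≡ f n + d n) → (∀ n → g (n + + 1) ≡ g n + d n) →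
                    ∀ n → f n ≡ g n
≡-from-increments {f} {g} d f₀≡g₀ f-step g-step =
  ℤ-induction (λ n → f n ≡ g n) f₀≡g₀
    (λ n fn≡gn → trans (f-step n) (trans (cong (_+ d n) fn≡gn) (sym (g-step n))))
    (λ n fn+1≡gn+1 → ∙-cancelʳ (d n) (f n) (g n)
                       (trans (sym (f-step n)) (trans fn+1≡gn+1 (g-step n))))

IsFibLike : (ℤ → ℤ) → Set
IsFibLike G = ∀ n → G (n + + 1 + + 1) ≡ G (n + + 1) + G n

-- The recurrence at negative indices, s being the alternating sign sgn in front of fibℕ/lucℕ.
alternating-step : ∀ s x y → s * x ≡ (- s) * y + (- - s) * (y + x)
alternating-step = solve-∀

F-fibLike : IsFibLike F
F-fibLike (+ k) rewrite ℕ.+-comm k 1 | ℕ.+-comm k 1 = refl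
F-fibLike -[1+ zero ]          = refl
F-fibLike -[1+ suc zero ]      = refl
F-fibLike -[1+ suc (suc m) ]   = alternating-step (sgn m) (fibℕ (suc m)) (fibℕ (suc (suc m)))

L-fibLike : IsFibLike L
L-fibLike (+ k) rewrite ℕ.+-comm k 1 | ℕ.+-comm k 1 = refl
L-fibLike -[1+ zero ]          = refl
L-fibLike -[1+ suc zero ]      = refl
L-fibLike -[1+ suc (suc m) ]   = alternating-step (sgn (suc m)) (lucℕ (suc m)) (lucℕ (suc (suc m)))

fibLike-shift : ∀ {G} k → IsFibLike G → IsFibLike (λ n → G (n + k))
fibLike-shift {G} k G-fib n = begin
  G (n + + 1 + + 1 + k)        ≡⟨ cong G (shift₂ n k) ⟩
  G (n + k + + 1 + + 1)        ≡⟨ G-fib (n + k) ⟩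
  G (n + k + + 1) + G (n + k)  ≡⟨ cong (λ i → G i + G (n + k)) (shift₁ n k) ⟨
  G (n + + 1 + k) + G (n + k)  ∎
  where
  shift₂ : ∀ n k → n + + 1 + + 1 + k ≡ n + k + + 1 + + 1
  shift₂ = solve-∀
  shift₁ : ∀ n k → n + + 1 + k ≡ n + k + + 1
  shift₁ = solve-∀

fibLike-combination : ∀ {G H} x y → IsFibLike G → IsFibLike H →
                      IsFibLike (λ n → x * G n + y * H n)
fibLike-combination {G} {H} x y G-fib H-fib n
  rewrite G-fib n | H-fib n = combine x y (G (n + + 1)) (G n) (H (n + + 1)) (H n)
  where
  combine : ∀ x y g₁ g₀ h₁ h₀ →
            x * (g₁ + g₀) + y * (h₁ + h₀) ≡ (x * g₁ + y * h₁) + (x * g₀ + y * h₀)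
  combine = solve-∀

fibLike-unique : ∀ {G H} → IsFibLike G → IsFibLike H →
                 G (+ 0) ≡ H (+ 0) → G (+ 1) ≡ H (+ 1) → ∀ n → G n ≡ H n
fibLike-unique {G} {H} G-fib H-fib G₀≡H₀ G₁≡H₁ n =
  proj₁ (ℤ-induction Agree (G₀≡H₀ , G₁≡H₁) up down n)
  where
  Agree : ℤ → Set
  Agree n = G n ≡ H n × G (n + + 1) ≡ H (n + + 1)
  up : ∀ n → Agree n → Agree (n + + 1)
  up n (eq₀ , eq₁) = eq₁ , trans (G-fib n) (trans (cong₂ _+_ eq₁ eq₀) (sym (H-fib n)))
  down : ∀ n → Agree (n + + 1) → Agree n
  down n (eq₁ , eq₂) =
    ∙-cancelˡ (G (n + + 1)) (G n) (H n)
      (trans (sym (G-fib n)) (trans eq₂ (trans (H-fib n) (cong (_+ H n) (sym eq₁))))) , eq₁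

fibLike-expansion : ∀ {G} → IsFibLike G →
                    ∀ n → G n ≡ (G (+ 1) - G (+ 0)) * F n + G (+ 0) * F (n + + 1)
fibLike-expansion {G} G-fib =
  fibLike-unique G-fib
    (fibLike-combination (G (+ 1) - G (+ 0)) (G (+ 0))
       F-fibLike (fibLike-shift {F} (+ 1) F-fibLike))
    (at₀ (G (+ 1)) (G (+ 0))) (at₁ (G (+ 1)) (G (+ 0)))
  where
  at₀ : ∀ x y → y ≡ (x - y) * + 0 + y * + 1
  at₀ = solve-∀
  at₁ : ∀ x y → x ≡ (x - y) * + 1 + y * + 1
  at₁ = solve-∀

F-add : ∀ m n → F (m + n) ≡ F (m - + 1) * F n + F m * F (n + + 1)
F-add m n = begin
  F (m + n)
    ≡⟨ cong F (+-comm m n) ⟩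
  F (n + m)
    ≡⟨ fibLike-expansion (fibLike-shift {F} m F-fibLike) n ⟩
  (F (+ 1 + m) - F (+ 0 + m)) * F n + F (+ 0 + m) * F (n + + 1)
    ≡⟨ cong₂ (λ c i → c * F n + F i * F (n + + 1)) difference (+-identityˡ m) ⟩
  F (m - + 1) * F n + F m * F (n + + 1)
    ∎
  where
  two-steps : ∀ m → + 1 + m ≡ m - + 1 + + 1 + + 1
  two-steps = solve-∀
  one-step : ∀ m → + 0 + m ≡ m - + 1 + + 1
  one-step = solve-∀
  add-sub : ∀ x y → x + y - x ≡ y
  add-sub = solve-∀
  difference : F (+ 1 + m) - F (+ 0 + m) ≡ F (m - + 1)
  difference = begin
    F (+ 1 + m) - F (+ 0 + m)
      ≡⟨ cong₂ (λ i j → F i - F j) (two-steps m) (one-step m) ⟩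
    F (m - + 1 + + 1 + + 1) - F (m - + 1 + + 1)
      ≡⟨ cong (_- F (m - + 1 + + 1)) (F-fibLike (m - + 1)) ⟩
    F (m - + 1 + + 1) + F (m - + 1) - F (m - + 1 + + 1)
      ≡⟨ add-sub (F (m - + 1 + + 1)) (F (m - + 1)) ⟩
    F (m - + 1)
      ∎

F-double : ∀ n → F (+ 2 * n + + 1) ≡ F n * F n + F (n + + 1) * F (n + + 1)
F-double n = begin
  F (+ 2 * n + + 1)
    ≡⟨ cong F (double n) ⟩
  F (n + + 1 + n)
    ≡⟨ F-add (n + + 1) n ⟩
  F (n + + 1 - + 1) * F n + F (n + + 1) * F (n + + 1)
    ≡⟨ cong (λ i → F i * F n + F (n + + 1) * F (n + + 1)) (back n) ⟩
  F n * F n + F (n + + 1) * F (n + + 1)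
    ∎
  where
  double : ∀ n → + 2 * n + + 1 ≡ n + + 1 + n
  double = solve-∀
  back : ∀ n → n + + 1 - + 1 ≡ n
  back = solve-∀

L-pred : ∀ n → L (n - + 1) ≡ + 3 * F n - F (n + + 1)
L-pred n = begin
  L (n - + 1)                         ≡⟨ fibLike-expansion (fibLike-shift {L} (- + 1) L-fibLike) n ⟩
  + 3 * F n + -1ℤ * F (n + + 1)        ≡⟨ cong (λ x → + 3 * F n + x) (-1*i≡-i (F (n + + 1))) ⟩
  + 3 * F n - F (n + + 1)             ∎

L-plus-two : ∀ n → L (n + + 2) ≡ F n + + 3 * F (n + + 1)
L-plus-two n = begin
  L (n + + 2)                         ≡⟨ fibLike-expansion (fibLike-shift {L} (+ 2) L-fibLike) n ⟩
  + 1 * F n + + 3 * F (n + + 1)        ≡⟨ cong (_+ + 3 * F (n + + 1)) (*-identityˡ (F n)) ⟩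
  F n + + 3 * F (n + + 1)             ∎

cassini : ℤ → ℤ
cassini n = F (n + + 1) * F (n + + 1) - F (n + + 1) * F n - F n * F n

cassini-succ : ∀ n → cassini (n + + 1) ≡ - cassini n
cassini-succ n rewrite F-fibLike n = flip (F n) (F (n + + 1))
  where
  flip : ∀ a b → (b + a) * (b + a) - (b + a) * b - b * b ≡ - (b * b - b * a - a * a)
  flip = solve-∀

cassini² : ∀ n → cassini n * cassini n ≡ + 1
cassini² = ℤ-induction (λ n → cassini n * cassini n ≡ + 1) refl
  (λ n sq≡1 → trans (square-succ n) sq≡1) (λ n sq≡1 → trans (sym (square-succ n)) sq≡1)
  where
  neg-square : ∀ x → - x * - x ≡ x * x
  neg-square = solve-∀
  square-succ : ∀ n → cassini (n + + 1) * cassini (n + + 1) ≡ cassini n * cassini n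
  square-succ n rewrite cassini-succ n = neg-square (cassini n)

sumTo-succ : ∀ a n → sumTo a (n + + 1) ≡ sumTo a n + a (n + + 1)
sumTo-succ a (+ k) rewrite ℕ.+-comm k 1 = refl
sumTo-succ a -[1+ zero ]  = sym (+-inverseˡ (a (+ 0)))
sumTo-succ a -[1+ suc i ] = peel (sumNeg a i) (a -[1+ i ])
  where
  peel : ∀ s t → - s ≡ - (s + t) + t
  peel = solve-∀

lhs : ℤ → ℤ
lhs n = + 25 * sumTo (λ k → F k ^ 4) n

rhs : ℤ → ℤ
rhs n = F (+ 2 * n + + 1) * L (n - + 1) * L (n + + 2) + + 6 * n + + 3

rhsPoly : ℤ → ℤ → ℤ → ℤ
rhsPoly a b m = (a * a + b * b) * (+ 3 * a - b) * (a + + 3 * b) + + 6 * m + + 3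

rhs≡rhsPoly : ∀ n → rhs n ≡ rhsPoly (F n) (F (n + + 1)) n
rhs≡rhsPoly n =
  cong (λ x → x + + 6 * n + + 3) (cong₂ _*_ (cong₂ _*_ (F-double n) (L-pred n)) (L-plus-two n))

rhsPoly-succ : ∀ a b m → (b * b - b * a - a * a) * (b * b - b * a - a * a) ≡ + 1 →
               rhsPoly b (b + a) (m + + 1) ≡ rhsPoly a b m + + 25 * b ^ 4
rhsPoly-succ a b m c²≡1 = ∙-cancelʳ (+ 6) _ _ (begin
  rhsPoly b (b + a) (m + + 1) + + 6
    ≡⟨ cong (λ x → rhsPoly b (b + a) (m + + 1) + + 6 * x) c²≡1 ⟨
  rhsPoly b (b + a) (m + + 1) + + 6 * (c * c)
    ≡⟨ step-identity a b m ⟩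
  rhsPoly a b m + + 25 * b ^ 4 + + 6
    ∎)
  where
  c : ℤ
  c = b * b - b * a - a * a
  -- b ^ 4 is unfolded: the ring solver does not handle _^_.
  step-identity : ∀ a b m →
    (b * b + (b + a) * (b + a)) * (+ 3 * b - (b + a)) * (b + + 3 * (b + a)) + + 6 * (m + + 1) + + 3
      + + 6 * ((b * b - b * a - a * a) * (b * b - b * a - a * a))
    ≡ (a * a + b * b) * (+ 3 * a - b) * (a + + 3 * b) + + 6 * m + + 3
      + + 25 * (b * (b * (b * (b * + 1)))) + + 6
  step-identity = solve-∀

lhs-succ : ∀ n → lhs (n + + 1) ≡ lhs n + + 25 * F (n + + 1) ^ 4
lhs-succ n = trans (cong (+ 25 *_) (sumTo-succ (λ k → F k ^ 4) n))
                   (*-distribˡ-+ (+ 25) (sumTo (λ k → F k ^ 4) n) (F (n + + 1) ^ 4))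

rhs-succ : ∀ n → rhs (n + + 1) ≡ rhs n + + 25 * F (n + + 1) ^ 4
rhs-succ n = begin
  rhs (n + + 1)
    ≡⟨ rhs≡rhsPoly (n + + 1) ⟩
  rhsPoly (F (n + + 1)) (F (n + + 1 + + 1)) (n + + 1)
    ≡⟨ cong (λ b → rhsPoly (F (n + + 1)) b (n + + 1)) (F-fibLike n) ⟩
  rhsPoly (F (n + + 1)) (F (n + + 1) + F n) (n + + 1)
    ≡⟨ rhsPoly-succ (F n) (F (n + + 1)) n (cassini² n) ⟩
  rhsPoly (F n) (F (n + + 1)) n + + 25 * F (n + + 1) ^ 4
    ≡⟨ cong (_+ + 25 * F (n + + 1) ^ 4) (rhs≡rhsPoly n) ⟨
  rhs n + + 25 * F (n + + 1) ^ 4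
    ∎

mainTheorem7 : (n : ℤ) →
    + 25 * sumTo (λ k → F k ^ 4) n
      ≡ F (+ 2 * n + + 1) * L (n - + 1) * L (n + + 2) + + 6 * n + + 3
mainTheorem7 = ≡-from-increments {lhs} {rhs} (λ n → + 25 * F (n + + 1) ^ 4) refl lhs-succ rhs-succ
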